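{- Let $\mathcal O_{ -2,-11}=\mathbb Z\oplus\mathbb Z\omega_1\oplus\mathbb Z\omega_2\oplus\mathbb Z\omega_3\subset\mathcal H_{ -2,-11}$ with $\omega_1=\frac{1+j}2$, $\omega_2=\frac{i+ij}2$, $\omega_3=\frac{3j+ij}{11}$. There exists a subgroup $H\le\mathcal G_{ -2,-11}(\mathbb Z/3\mathbb Z)$ with $H\cong C_2$ such that $(3,H)$ is a congruence pair of $\mathcal O_{ -2,-11}$.
   Context: $\mathcal H_{ -2,-11}$ is the quaternion algebra over $\mathbb Q$ with basis $1,i,j,ij$, $i^2=-2$, $j^2=-11$, $ij=-ji$; $\mathcal O_{ -2,-11}$ is a maximal order. For a commutative ring $A$, $\mathcal G_{ -2,-11}(A)=(\mathcal O_{ -2,-11}\otimes A)^\times/A^\times$. $\phi_m:\mathcal G_{ -2,-11}(\mathbb Z)\to\mathcal G_{ -2,-11}(\mathbb Z/m\mathbb Z)$ is induced by reducing coordinates with respect to the basis $1,\omega_1,\omega_2,\omega_3$ modulo $m$. A congruence pair is $(m,H)$, $m$ a positive integer, $H\le\mathcal G_{ -2,-11}(\mathbb Z/m\mathbb Z)$, such that $\phi_m$ is injective on $\mathcal G_{ -2,-11}(\mathbb Z)$, $H\cap\phi_m(\mathcal G_{ -2,-11}(\mathbb Z))=\{1\}$ and $\phi_m(\mathcal G_{ -2,-11}(\mathbb Z))\cdot H=\mathcal G_{ -2,-11}(\mathbb Z/m\mathbb Z)$. $C_2$ is the cyclic group of order $2$. -}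

module Defs where

-- Concrete model of the maximal order O_{-2,-11} of the quaternion algebra
-- H_{-2,-11} (i² = -2, j² = -11, ij = -ji), and of the groups
-- G(ℤ) = O^× / ℤ^× and G(ℤ/mℤ) = (O ⊗ ℤ/mℤ)^× / (ℤ/mℤ)^×.

open import Data.Nat using (ℕ)
open import Data.Fin using (Fin; zero; suc)
open import Data.Integer using (ℤ; +_; -_; _+_; _-_; _*_)
open import Data.Integer.Divisibility using (_∣_)
open import Data.Product using (Σ; _×_; _,_)
open import Data.Sum using (_⊎_)
open import Relation.Nullary using (¬_)
open import Relation.Binary.PropositionalEquality using (_≡_; refl)

-- Elements of O (and, via integer representatives, of O ⊗ ℤ/mℤ):
-- q a₀ a₁ a₂ a₃ stands for a₀ + a₁ ω₁ + a₂ ω₂ + a₃ ω₃, where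
-- ω₁ = (1 + j)/2, ω₂ = (i + ij)/2, ω₃ = (3j + ij)/11.

record Q : Set where
  constructor q
  field
    c₀ c₁ c₂ c₃ : ℤ

-- Multiplication in O, in coordinates w.r.t. 1, ω₁, ω₂, ω₃
-- (structure constants certified below by `table-ok`).
_·_ : Q → Q → Q
q a₀ a₁ a₂ a₃ · q b₀ b₁ b₂ b₃ = q
   ((+ 1) * a₀ * b₀ + (- (+ 3)) * a₁ * b₁ + (- (+ 9)) * a₁ * b₂ + (- (+ 3)) * a₁ * b₃ + (+ 9) * a₂ * b₁ + (- (+ 6)) * a₂ * b₂ + (+ 4) * a₂ * b₃ + (- (+ 6)) * a₃ * b₂ + (- (+ 1)) * a₃ * b₃)
   ((+ 1) * a₀ * b₁ + (+ 1) * a₁ * b₀ + (+ 1) * a₁ * b₁ + (+ 18) * a₁ * b₂ + (+ 3) * a₁ * b₃ + (- (+ 18)) * a₂ * b₁ + (- (+ 10)) * a₂ * b₃ + (- (+ 3)) * a₃ * b₁ + (+ 10) * a₃ * b₂)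
   ((+ 1) * a₀ * b₂ + (+ 6) * a₁ * b₂ + (+ 1) * a₁ * b₃ + (+ 1) * a₂ * b₀ + (- (+ 5)) * a₂ * b₁ + (- (+ 3)) * a₂ * b₃ + (- (+ 1)) * a₃ * b₁ + (+ 3) * a₃ * b₂)
   ((+ 1) * a₀ * b₃ + (- (+ 33)) * a₁ * b₂ + (- (+ 5)) * a₁ * b₃ + (+ 33) * a₂ * b₁ + (+ 18) * a₂ * b₃ + (+ 1) * a₃ * b₀ + (+ 6) * a₃ * b₁ + (- (+ 18)) * a₃ * b₂)

infixl 7 _·_
infix 4 _≋_[mod_] _≈[_]_ _∼[_]_

one : Q
one = q (+ 1) (+ 0) (+ 0) (+ 0)

neg : Q → Q
neg (q a₀ a₁ a₂ a₃) = q (- a₀) (- a₁) (- a₂) (- a₃)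

scale : ℤ → Q → Q
scale c (q a₀ a₁ a₂ a₃) = q (c * a₀) (c * a₁) (c * a₂) (c * a₃)

-- Certification of the structure constants: the standard model of
-- H_{-2,-11} with basis 1, i, j, ij (coordinates in ℤ), and the map
-- x ↦ 22x from O into it.  For all basis elements e_a, e_b of O,
-- (22 e_a)(22 e_b) = 22 · (22 (e_a · e_b)); by bilinearity this shows that
-- _·_ is the multiplication of H_{-2,-11} restricted to O.

record H : Set where
  constructor h
  field
    x₀ x₁ x₂ x₃ : ℤ

_⋆_ : H → H → H
h x₀ x₁ x₂ x₃ ⋆ h y₀ y₁ y₂ y₃ = h
  (x₀ * y₀ - (+ 2) * x₁ * y₁ - (+ 11) * x₂ * y₂ - (+ 22) * x₃ * y₃)
  (x₀ * y₁ + x₁ * y₀ + (+ 11) * x₂ * y₃ - (+ 11) * x₃ * y₂)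
  (x₀ * y₂ + x₂ * y₀ - (+ 2) * x₁ * y₃ + (+ 2) * x₃ * y₁)
  (x₀ * y₃ + x₃ * y₀ + x₁ * y₂ - x₂ * y₁)

scaleH : ℤ → H → H
scaleH c (h x₀ x₁ x₂ x₃) = h (c * x₀) (c * x₁) (c * x₂) (c * x₃)

-- 22 (a₀ + a₁ω₁ + a₂ω₂ + a₃ω₃) in the basis 1, i, j, ij
emb22 : Q → H
emb22 (q a₀ a₁ a₂ a₃) = h ((+ 22) * a₀ + (+ 11) * a₁) ((+ 11) * a₂)
                          ((+ 11) * a₁ + (+ 6) * a₃) ((+ 11) * a₂ + (+ 2) * a₃)

basis : Fin 4 → Q
basis zero = q (+ 1) (+ 0) (+ 0) (+ 0)
basis (suc zero) = q (+ 0) (+ 1) (+ 0) (+ 0)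
basis (suc (suc zero)) = q (+ 0) (+ 0) (+ 1) (+ 0)
basis (suc (suc (suc zero))) = q (+ 0) (+ 0) (+ 0) (+ 1)

table-ok : ∀ a b →
  emb22 (basis a) ⋆ emb22 (basis b) ≡ scaleH (+ 22) (emb22 (basis a · basis b))
table-ok zero zero = refl
table-ok zero (suc zero) = refl
table-ok zero (suc (suc zero)) = refl
table-ok zero (suc (suc (suc zero))) = refl
table-ok (suc zero) zero = refl
table-ok (suc zero) (suc zero) = refl
table-ok (suc zero) (suc (suc zero)) = refl
table-ok (suc zero) (suc (suc (suc zero))) = refl
table-ok (suc (suc zero)) zero = refl
table-ok (suc (suc zero)) (suc zero) = refl
table-ok (suc (suc zero)) (suc (suc zero)) = refl
table-ok (suc (suc zero)) (suc (suc (suc zero))) = refl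
table-ok (suc (suc (suc zero))) zero = refl
table-ok (suc (suc (suc zero))) (suc zero) = refl
table-ok (suc (suc (suc zero))) (suc (suc zero)) = refl
table-ok (suc (suc (suc zero))) (suc (suc (suc zero))) = refl

IsUnitℤ : Q → Set
IsUnitℤ u = Σ Q λ v → (u · v ≡ one) × (v · u ≡ one)

-- ℤ/mℤ via integer representatives: congruence modulo m.

_≋_[mod_] : ℤ → ℤ → ℕ → Set
a ≋ b [mod m ] = (+ m) ∣ (a - b)

-- equality in O ⊗ ℤ/mℤ (coordinatewise congruence)
_≈[_]_ : Q → ℕ → Q → Set
q a₀ a₁ a₂ a₃ ≈[ m ] q b₀ b₁ b₂ b₃ =
  (a₀ ≋ b₀ [mod m ]) × (a₁ ≋ b₁ [mod m ]) × (a₂ ≋ b₂ [mod m ]) × (a₃ ≋ b₃ [mod m ])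

IsUnitMod : ℕ → Q → Set
IsUnitMod m x = Σ Q λ y → (x · y ≈[ m ] one) × (y · x ≈[ m ] one)

IsScalarUnitMod : ℕ → ℤ → Set
IsScalarUnitMod m c = Σ ℤ λ d → c * d ≋ + 1 [mod m ]

-- equality in G(ℤ/mℤ) = (O ⊗ ℤ/mℤ)^× / (ℤ/mℤ)^× (on representatives)
_∼[_]_ : Q → ℕ → Q → Set
x ∼[ m ] y = Σ ℤ λ c → IsScalarUnitMod m c × (x ≈[ m ] scale c y)

-- φ_m : reduction of coordinates modulo m (an integer tuple is its own
-- representative in O ⊗ ℤ/mℤ)
φ : ℕ → Q → Q
φ m x = x

-- Subgroups of G(ℤ/mℤ), given as predicates on representatives.

record IsSubgroup (m : ℕ) (S : Q → Set) : Set where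
  field
    respects : ∀ x y → x ∼[ m ] y → S x → S y
    units    : ∀ x → S x → IsUnitMod m x
    has-one  : S one
    closed·  : ∀ x y → S x → S y → S (x · y)
    closed⁻¹ : ∀ x y → S x → x · y ≈[ m ] one → S y

IsoC₂ : ℕ → (Q → Set) → Set
IsoC₂ m S = Σ Q λ g → S g × ¬ (g ∼[ m ] one) ×
  (∀ x → S x → (x ∼[ m ] one) ⊎ (x ∼[ m ] g))

record IsCongruencePair (m : ℕ) (S : Q → Set) : Set where
  field
    -- φ_m is injective on G(ℤ) = O^× / {±1}
    injective    : ∀ u v → IsUnitℤ u → IsUnitℤ v → φ m u ∼[ m ] φ m v →
                   (u ≡ v) ⊎ (u ≡ neg v)
    trivial-meet : ∀ u x → IsUnitℤ u → S x → φ m u ∼[ m ] x → x ∼[ m ] one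
    covers       : ∀ x → IsUnitMod m x →
                   Σ Q λ u → Σ Q λ s → IsUnitℤ u × S s × (x ∼[ m ] (φ m u · s))

{-# OPTIONS --safe #-}
module Submission where

-- The reduced norm nrm is a positive definite quaternary form, and writing suitable multiples of it
-- as weighted sums of squares bounds every coordinate of an element of norm 1; hence O^× consists of
-- 24 explicit units and G(ℤ) has 12 elements.  Modulo 3 the class of g = 1 + ω₁ is an involution,
-- and since nrm g = 5 is not a square modulo 3, while units of O have norm 1 and rescaling by a unit
-- of ℤ/3ℤ multiplies the norm by a square, H = {1, g} ≅ C₂ meets φ₃(G(ℤ)) trivially.  As G(ℤ/3ℤ)
-- has 24 = 12 · 2 elements, φ₃(G(ℤ)) · H is all of it.  Every statement modulo 3 is invariant under
-- reducing coordinates, so it only concerns the 3⁴ reduced coordinate vectors and is settled by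
-- exhaustive search.

open import Defs
open import Algebra.Bundles.Raw using (RawRing)
open import Data.Empty using (⊥-elim)
open import Data.Fin using (#_)
open import Data.Integer using (ℤ; +_; -[1+_]; ∣_∣; +-*-rawRing)
open import Data.Integer.DivMod using (_%_; _/_; a≡a%n+[a/n]*n; n%d<d)
open import Data.Integer.Divisibility.Signed using (divides; ∣ᵤ⇒∣; ∣⇒∣ᵤ)
import Data.Integer.Properties as ℤ
open import Algebra.Properties.CommutativeSemigroup ℤ.*-commutativeSemigroup using (interchange)
open import Data.Integer.Tactic.RingSolver using (ring; solve-∀)
open import Data.List using (List; []; _∷_; map; upTo; concatMap; _++_)
open import Data.List.Membership.Propositional using (_∈_; lose; find)
open import Data.List.Membership.Propositional.Properties using (∈-map⁺; ∈-upTo⁺; ∈-++⁺ˡ; ∈-++⁺ʳ)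
open import Data.List.Relation.Unary.All as All using (All; all?)
open import Data.List.Relation.Unary.Any as Any using (Any; any?; here; there)
open import Data.Nat as ℕ using (ℕ; suc; NonZero; _≤_; _<_; s≤s)
import Data.Nat.Divisibility as ℕ
import Data.Nat.Properties as ℕ
open import Data.Product using (Σ; _×_; _,_)
open import Data.Sum using (_⊎_; inj₁; inj₂)
open import Data.Vec using (Vec; []; _∷_)
open import Function using (id)
open import Relation.Binary.Bundles using (Setoid)
open import Relation.Binary.Definitions using (DecidableEquality)
open import Relation.Binary.PropositionalEquality
  using (_≡_; refl; sym; trans; cong; cong₂; subst; module ≡-Reasoning)
import Relation.Binary.Reasoning.Setoid as SetoidReasoning
open import Relation.Nullary.Decidable
  using (Dec; yes; no; map′; from-yes; from-no; _→-dec_; _×-dec_; _⊎-dec_; ¬?)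
open import Relation.Nullary.Negation using (¬_; contradiction)
open import Tactic.RingSolver.NonReflective ring using (Expr; Κ; Ι; ⊝_; module Ops)
  renaming (_⊕_ to _⊕ₑ_; _⊗_ to _⊗ₑ_)
open Ops using (⟦_⟧; ⟦_⇓⟧; prove)

-- Forms in the coordinates over any raw ring, with integer constants κ.  They are instantiated at ℤ
-- and at ring-solver expressions, whose evaluation unfolds to the ℤ instance by definition.
module Forms {c ℓ} (R : RawRing c ℓ) (κ : ℤ → RawRing.Carrier R) where

  open RawRing R

  norm-form : Carrier → Carrier → Carrier → Carrier → Carrier
  norm-form a₀ a₁ a₂ a₃ =
    a₀ * a₀ + a₀ * a₁ + κ (+ 3) * a₁ * a₁ + κ (+ 6) * a₂ * a₂ + κ (+ 3) * a₁ * a₃ + κ (+ 2) * a₂ * a₃ + a₃ * a₃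

  weighted-squares : List (ℕ × Carrier) → Carrier
  weighted-squares [] = 0#
  weighted-squares ((k , a) ∷ ws) = κ (+ k) * (a * a) + weighted-squares ws

  -- Decompositions of 12, 60, 44 and 132 times the norm form (see nrm-squares₀ … nrm-squares₃)
  -- whose first square is that of a single coordinate.
  squares₀ squares₁ squares₂ squares₃ : Carrier → Carrier → Carrier → Carrier → List (ℕ × Carrier)
  squares₀ a₀ a₁ a₂ a₃ =
    (2 , a₀) ∷ (1 , κ (+ 6) * a₁ + κ (+ 3) * a₃ + a₀) ∷ (2 , κ (+ 6) * a₂ + a₃) ∷ (1 , κ (+ 3) * a₀ + - a₃) ∷ []
  squares₁ a₀ a₁ a₂ a₃ =
    (3 , a₁) ∷ (15 , κ (+ 2) * a₀ + a₁) ∷ (10 , κ (+ 6) * a₂ + a₃) ∷ (2 , κ (+ 5) * a₃ + κ (+ 9) * a₁) ∷ []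
  squares₂ a₀ a₁ a₂ a₃ =
    (22 , a₂) ∷ (11 , κ (+ 2) * a₀ + a₁) ∷ (1 , κ (+ 11) * a₁ + κ (+ 6) * a₃) ∷ (2 , κ (+ 2) * a₃ + κ (+ 11) * a₂) ∷ []
  squares₃ a₀ a₁ a₂ a₃ =
    (2 , a₃) ∷ (33 , κ (+ 2) * a₀ + a₁) ∷ (3 , κ (+ 11) * a₁ + κ (+ 6) * a₃) ∷ (22 , κ (+ 6) * a₂ + a₃) ∷ []

-- Imported only here: inside Forms these operators are those of the raw ring.
open import Data.Integer using (_+_; _-_; _*_; -_)

open Forms +-*-rawRing id public

Expr-rawRing : ℕ → RawRing _ _
Expr-rawRing n = record
  { Carrier = Expr ℤ n ; _≈_ = _≡_ ; _+_ = _⊕ₑ_ ; _*_ = _⊗ₑ_ ; -_ = ⊝_ ; 0# = Κ (+ 0) ; 1# = Κ (+ 1) }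

module Formsₑ {n : ℕ} = Forms (Expr-rawRing n) Κ

nrm : Q → ℤ
nrm (q a₀ a₁ a₂ a₃) = norm-form a₀ a₁ a₂ a₃

infixl 6 _⊕_

_⊕_ : Q → Q → Q
q a₀ a₁ a₂ a₃ ⊕ q b₀ b₁ b₂ b₃ = q (a₀ + b₀) (a₁ + b₁) (a₂ + b₂) (a₃ + b₃)

q-cong : ∀ {a₀ a₁ a₂ a₃ b₀ b₁ b₂ b₃} → a₀ ≡ b₀ → a₁ ≡ b₁ → a₂ ≡ b₂ → a₃ ≡ b₃ →
         q a₀ a₁ a₂ a₃ ≡ q b₀ b₁ b₂ b₃
q-cong refl refl refl refl = refl

record Qₑ (n : ℕ) : Set where
  constructor qₑ
  field
    e₀ e₁ e₂ e₃ : Expr ℤ n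

module _ {n : ℕ} where

  infixl 6 _+ₑ_
  infixl 7 _·ₑ_

  -- The structure constants of _·_, over solver expressions: ⟦ x ·ₑ y ⟧Q ρ unfolds to the product
  -- in O of ⟦ x ⟧Q ρ and ⟦ y ⟧Q ρ, so Q-identity below proves identities about _·_.
  _·ₑ_ : Qₑ n → Qₑ n → Qₑ n
  qₑ a₀ a₁ a₂ a₃ ·ₑ qₑ b₀ b₁ b₂ b₃ = qₑ
    (Κ (+ 1) ⊗ₑ a₀ ⊗ₑ b₀ ⊕ₑ Κ (- (+ 3)) ⊗ₑ a₁ ⊗ₑ b₁ ⊕ₑ Κ (- (+ 9)) ⊗ₑ a₁ ⊗ₑ b₂ ⊕ₑ Κ (- (+ 3)) ⊗ₑ a₁ ⊗ₑ b₃
       ⊕ₑ Κ (+ 9) ⊗ₑ a₂ ⊗ₑ b₁ ⊕ₑ Κ (- (+ 6)) ⊗ₑ a₂ ⊗ₑ b₂ ⊕ₑ Κ (+ 4) ⊗ₑ a₂ ⊗ₑ b₃ ⊕ₑ Κ (- (+ 6)) ⊗ₑ a₃ ⊗ₑ b₂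
       ⊕ₑ Κ (- (+ 1)) ⊗ₑ a₃ ⊗ₑ b₃)
    (Κ (+ 1) ⊗ₑ a₀ ⊗ₑ b₁ ⊕ₑ Κ (+ 1) ⊗ₑ a₁ ⊗ₑ b₀ ⊕ₑ Κ (+ 1) ⊗ₑ a₁ ⊗ₑ b₁ ⊕ₑ Κ (+ 18) ⊗ₑ a₁ ⊗ₑ b₂
       ⊕ₑ Κ (+ 3) ⊗ₑ a₁ ⊗ₑ b₃ ⊕ₑ Κ (- (+ 18)) ⊗ₑ a₂ ⊗ₑ b₁ ⊕ₑ Κ (- (+ 10)) ⊗ₑ a₂ ⊗ₑ b₃
       ⊕ₑ Κ (- (+ 3)) ⊗ₑ a₃ ⊗ₑ b₁ ⊕ₑ Κ (+ 10) ⊗ₑ a₃ ⊗ₑ b₂)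
    (Κ (+ 1) ⊗ₑ a₀ ⊗ₑ b₂ ⊕ₑ Κ (+ 6) ⊗ₑ a₁ ⊗ₑ b₂ ⊕ₑ Κ (+ 1) ⊗ₑ a₁ ⊗ₑ b₃ ⊕ₑ Κ (+ 1) ⊗ₑ a₂ ⊗ₑ b₀
       ⊕ₑ Κ (- (+ 5)) ⊗ₑ a₂ ⊗ₑ b₁ ⊕ₑ Κ (- (+ 3)) ⊗ₑ a₂ ⊗ₑ b₃ ⊕ₑ Κ (- (+ 1)) ⊗ₑ a₃ ⊗ₑ b₁
       ⊕ₑ Κ (+ 3) ⊗ₑ a₃ ⊗ₑ b₂)
    (Κ (+ 1) ⊗ₑ a₀ ⊗ₑ b₃ ⊕ₑ Κ (- (+ 33)) ⊗ₑ a₁ ⊗ₑ b₂ ⊕ₑ Κ (- (+ 5)) ⊗ₑ a₁ ⊗ₑ b₃ ⊕ₑ Κ (+ 33) ⊗ₑ a₂ ⊗ₑ b₁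
       ⊕ₑ Κ (+ 18) ⊗ₑ a₂ ⊗ₑ b₃ ⊕ₑ Κ (+ 1) ⊗ₑ a₃ ⊗ₑ b₀ ⊕ₑ Κ (+ 6) ⊗ₑ a₃ ⊗ₑ b₁ ⊕ₑ Κ (- (+ 18)) ⊗ₑ a₃ ⊗ₑ b₂)

  _+ₑ_ : Qₑ n → Qₑ n → Qₑ n
  qₑ a₀ a₁ a₂ a₃ +ₑ qₑ b₀ b₁ b₂ b₃ = qₑ (a₀ ⊕ₑ b₀) (a₁ ⊕ₑ b₁) (a₂ ⊕ₑ b₂) (a₃ ⊕ₑ b₃)

  scaleₑ : Expr ℤ n → Qₑ n → Qₑ n
  scaleₑ c (qₑ a₀ a₁ a₂ a₃) = qₑ (c ⊗ₑ a₀) (c ⊗ₑ a₁) (c ⊗ₑ a₂) (c ⊗ₑ a₃)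

  negₑ : Qₑ n → Qₑ n
  negₑ (qₑ a₀ a₁ a₂ a₃) = qₑ (⊝ a₀) (⊝ a₁) (⊝ a₂) (⊝ a₃)

  nrmₑ : Qₑ n → Expr ℤ n
  nrmₑ (qₑ a₀ a₁ a₂ a₃) = Formsₑ.norm-form a₀ a₁ a₂ a₃

  ⟦_⟧Q : Qₑ n → Vec ℤ n → Q
  ⟦ qₑ a₀ a₁ a₂ a₃ ⟧Q ρ = q (⟦ a₀ ⟧ ρ) (⟦ a₁ ⟧ ρ) (⟦ a₂ ⟧ ρ) (⟦ a₃ ⟧ ρ)

  open Qₑ

  Q-identity : ∀ ρ x y → ⟦ e₀ x ⇓⟧ ρ ≡ ⟦ e₀ y ⇓⟧ ρ → ⟦ e₁ x ⇓⟧ ρ ≡ ⟦ e₁ y ⇓⟧ ρ →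
               ⟦ e₂ x ⇓⟧ ρ ≡ ⟦ e₂ y ⇓⟧ ρ → ⟦ e₃ x ⇓⟧ ρ ≡ ⟦ e₃ y ⇓⟧ ρ → ⟦ x ⟧Q ρ ≡ ⟦ y ⟧Q ρ
  Q-identity ρ (qₑ a₀ a₁ a₂ a₃) (qₑ b₀ b₁ b₂ b₃) p₀ p₁ p₂ p₃ =
    q-cong (prove ρ a₀ b₀ p₀) (prove ρ a₁ b₁ p₁) (prove ρ a₂ b₂ p₂) (prove ρ a₃ b₃ p₃)

-- Identities below are in two scalars and three elements of O, evaluated in env and named C, D, X, Y, Z;
-- an identity ignores the positions it does not use.
env : ℤ → ℤ → Q → Q → Q → Vec ℤ 14
env c d (q a₀ a₁ a₂ a₃) (q b₀ b₁ b₂ b₃) (q c₀ c₁ c₂ c₃) =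
  c ∷ d ∷ a₀ ∷ a₁ ∷ a₂ ∷ a₃ ∷ b₀ ∷ b₁ ∷ b₂ ∷ b₃ ∷ c₀ ∷ c₁ ∷ c₂ ∷ c₃ ∷ []

C D x₀ x₁ x₂ x₃ : Expr ℤ 14
C = Ι (# 0)
D = Ι (# 1)
x₀ = Ι (# 2)
x₁ = Ι (# 3)
x₂ = Ι (# 4)
x₃ = Ι (# 5)

X Y Z : Qₑ 14
X = qₑ x₀ x₁ x₂ x₃
Y = qₑ (Ι (# 6)) (Ι (# 7)) (Ι (# 8)) (Ι (# 9))
Z = qₑ (Ι (# 10)) (Ι (# 11)) (Ι (# 12)) (Ι (# 13))

scale-identity : ∀ x → scale (+ 1) x ≡ x
scale-identity x = Q-identity (env (+ 0) (+ 0) x x x) (scaleₑ (Κ (+ 1)) X) X refl refl refl refl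

scale-scale : ∀ c d x → scale c (scale d x) ≡ scale (c * d) x
scale-scale c d x = Q-identity (env c d x x x) (scaleₑ C (scaleₑ D X)) (scaleₑ (C ⊗ₑ D) X) refl refl refl refl

scale-·-scale : ∀ c d x y → scale c x · scale d y ≡ scale (c * d) (x · y)
scale-·-scale c d x y =
  Q-identity (env c d x y y) (scaleₑ C X ·ₑ scaleₑ D Y) (scaleₑ (C ⊗ₑ D) (X ·ₑ Y)) refl refl refl refl

·-distribʳ-offset : ∀ k x d y → (x ⊕ scale k d) · y ≡ x · y ⊕ scale k (d · y)
·-distribʳ-offset k x d y =
  Q-identity (env k k x d y) ((X +ₑ scaleₑ C Y) ·ₑ Z) (X ·ₑ Z +ₑ scaleₑ C (Y ·ₑ Z)) refl refl refl refl

·-distribˡ-offset : ∀ k x y d → x · (y ⊕ scale k d) ≡ x · y ⊕ scale k (x · d)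
·-distribˡ-offset k x y d =
  Q-identity (env k k x y d) (X ·ₑ (Y +ₑ scaleₑ C Z)) (X ·ₑ Y +ₑ scaleₑ C (X ·ₑ Z)) refl refl refl refl

nrm-· : ∀ x y → nrm (x · y) ≡ nrm x * nrm y
nrm-· x y = prove (env (+ 0) (+ 0) x y y) (nrmₑ (X ·ₑ Y)) (nrmₑ X ⊗ₑ nrmₑ Y) refl

nrm-squares₀ : ∀ a₀ a₁ a₂ a₃ → + 12 * nrm (q a₀ a₁ a₂ a₃) ≡ weighted-squares (squares₀ a₀ a₁ a₂ a₃)
nrm-squares₀ a₀ a₁ a₂ a₃ = prove (env (+ 0) (+ 0) (q a₀ a₁ a₂ a₃) one one)
  (Κ (+ 12) ⊗ₑ nrmₑ X) (Formsₑ.weighted-squares (Formsₑ.squares₀ x₀ x₁ x₂ x₃)) refl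

nrm-squares₁ : ∀ a₀ a₁ a₂ a₃ → + 60 * nrm (q a₀ a₁ a₂ a₃) ≡ weighted-squares (squares₁ a₀ a₁ a₂ a₃)
nrm-squares₁ a₀ a₁ a₂ a₃ = prove (env (+ 0) (+ 0) (q a₀ a₁ a₂ a₃) one one)
  (Κ (+ 60) ⊗ₑ nrmₑ X) (Formsₑ.weighted-squares (Formsₑ.squares₁ x₀ x₁ x₂ x₃)) refl

nrm-squares₂ : ∀ a₀ a₁ a₂ a₃ → + 44 * nrm (q a₀ a₁ a₂ a₃) ≡ weighted-squares (squares₂ a₀ a₁ a₂ a₃)
nrm-squares₂ a₀ a₁ a₂ a₃ = prove (env (+ 0) (+ 0) (q a₀ a₁ a₂ a₃) one one)
  (Κ (+ 44) ⊗ₑ nrmₑ X) (Formsₑ.weighted-squares (Formsₑ.squares₂ x₀ x₁ x₂ x₃)) refl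

nrm-squares₃ : ∀ a₀ a₁ a₂ a₃ → + 132 * nrm (q a₀ a₁ a₂ a₃) ≡ weighted-squares (squares₃ a₀ a₁ a₂ a₃)
nrm-squares₃ a₀ a₁ a₂ a₃ = prove (env (+ 0) (+ 0) (q a₀ a₁ a₂ a₃) one one)
  (Κ (+ 132) ⊗ₑ nrmₑ X) (Formsₑ.weighted-squares (Formsₑ.squares₃ x₀ x₁ x₂ x₃)) refl

infix 4 _≡_[mod_] _≅_[mod_]

-- Congruences with an explicit quotient.  Unlike _≋_[mod_], which states divisibility of absolute
-- values, their indices can be inferred and their closure properties are ring identities.
record _≡_[mod_] (a b n : ℤ) : Set where
  constructor mod-by
  field
    quotient : ℤ
    offset   : a ≡ b + n * quotient

record _≅_[mod_] (x y : Q) (n : ℤ) : Set where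
  constructor mod-by
  field
    quotient : Q
    offset   : x ≡ y ⊕ scale n quotient

private
  offset-zero : ∀ a n → a ≡ a + n * + 0
  offset-zero = solve-∀

  offset-neg : ∀ b n k → b ≡ (b + n * k) + n * - k
  offset-neg = solve-∀

  offset-+ : ∀ c n k l → (c + n * l) + n * k ≡ c + n * (l + k)
  offset-+ = solve-∀

  offset-* : ∀ a b n k l → (a + n * k) * (b + n * l) ≡ a * b + n * (k * b + a * l + n * k * l)
  offset-* = solve-∀

  offset-*ʳ : ∀ c n k a → (c + n * k) * a ≡ c * a + n * (k * a)
  offset-*ʳ = solve-∀

  plus-minus : ∀ a b → a ≡ b + (a - b)
  plus-minus = solve-∀

  offset-minus : ∀ b n k → (b + n * k) - b ≡ k * n
  offset-minus = solve-∀

≡-mod-refl : ∀ {n a} → a ≡ a [mod n ]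
≡-mod-refl {n} {a} = mod-by (+ 0) (offset-zero a n)

≡-mod-reflexive : ∀ {n a b} → a ≡ b → a ≡ b [mod n ]
≡-mod-reflexive refl = ≡-mod-refl

≡-mod-sym : ∀ {n a b} → a ≡ b [mod n ] → b ≡ a [mod n ]
≡-mod-sym {n} {b = b} (mod-by k refl) = mod-by (- k) (offset-neg b n k)

≡-mod-trans : ∀ {n a b c} → a ≡ b [mod n ] → b ≡ c [mod n ] → a ≡ c [mod n ]
≡-mod-trans {n} {c = c} (mod-by k refl) (mod-by l refl) = mod-by (l + k) (offset-+ c n k l)

*-cong-mod : ∀ {n a a′ b b′} → a ≡ a′ [mod n ] → b ≡ b′ [mod n ] → a * b ≡ a′ * b′ [mod n ]
*-cong-mod {n} {a′ = a′} {b′ = b′} (mod-by k refl) (mod-by l refl) =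
  mod-by (k * b′ + a′ * l + n * k * l) (offset-* a′ b′ n k l)

≋⇒≡-mod : ∀ {m} a b → a ≋ b [mod m ] → a ≡ b [mod + m ]
≋⇒≡-mod {m} a b m∣a-b with ∣ᵤ⇒∣ m∣a-b
... | divides k a-b≡km =
  mod-by k (trans (plus-minus a b) (cong (_+_ b) (trans a-b≡km (ℤ.*-comm k (+ m)))))

≡-mod⇒≋ : ∀ {m a b} → a ≡ b [mod + m ] → a ≋ b [mod m ]
≡-mod⇒≋ {m} {b = b} (mod-by k refl) = ∣⇒∣ᵤ (divides k (offset-minus b (+ m) k))

≅-refl : ∀ {n x} → x ≅ x [mod n ]
≅-refl {n} {x} = mod-by (scale (+ 0) x)
  (Q-identity (env n n x x x) X (X +ₑ scaleₑ C (scaleₑ (Κ (+ 0)) X)) refl refl refl refl)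

≅-reflexive : ∀ {n x y} → x ≡ y → x ≅ y [mod n ]
≅-reflexive refl = ≅-refl

≅-sym : ∀ {n x y} → x ≅ y [mod n ] → y ≅ x [mod n ]
≅-sym {n} {y = y} (mod-by d refl) = mod-by (neg d)
  (Q-identity (env n n y d d) X ((X +ₑ scaleₑ C Y) +ₑ scaleₑ C (negₑ Y)) refl refl refl refl)

≅-trans : ∀ {n x y z} → x ≅ y [mod n ] → y ≅ z [mod n ] → x ≅ z [mod n ]
≅-trans {n} {z = z} (mod-by d refl) (mod-by e refl) = mod-by (e ⊕ d)
  (Q-identity (env n n z e d) ((X +ₑ scaleₑ C Y) +ₑ scaleₑ C Z) (X +ₑ scaleₑ C (Y +ₑ Z)) refl refl refl refl)

≅-setoid : ℤ → Setoid _ _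
≅-setoid n = record
  { Carrier = Q
  ; _≈_ = λ x y → x ≅ y [mod n ]
  ; isEquivalence = record { refl = ≅-refl ; sym = ≅-sym ; trans = ≅-trans }
  }

·-congˡ : ∀ {n x x′} y → x ≅ x′ [mod n ] → x · y ≅ x′ · y [mod n ]
·-congˡ {n} {x′ = x′} y (mod-by d refl) = mod-by (d · y) (·-distribʳ-offset n x′ d y)

·-congʳ : ∀ {n y y′} x → y ≅ y′ [mod n ] → x · y ≅ x · y′ [mod n ]
·-congʳ {n} {y′ = y′} x (mod-by d refl) = mod-by (x · d) (·-distribˡ-offset n x y′ d)

·-cong : ∀ {n x x′ y y′} → x ≅ x′ [mod n ] → y ≅ y′ [mod n ] → x · y ≅ x′ · y′ [mod n ]
·-cong {x′ = x′} {y = y} x≅x′ y≅y′ = ≅-trans (·-congˡ y x≅x′) (·-congʳ x′ y≅y′)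

scale-congˡ : ∀ {n c c′} x → c ≡ c′ [mod n ] → scale c x ≅ scale c′ x [mod n ]
scale-congˡ {n} {c′ = c′} (q a₀ a₁ a₂ a₃) (mod-by k refl) = mod-by (scale k (q a₀ a₁ a₂ a₃))
  (q-cong (offset-*ʳ c′ n k a₀) (offset-*ʳ c′ n k a₁) (offset-*ʳ c′ n k a₂) (offset-*ʳ c′ n k a₃))

scale-congʳ : ∀ {n x y} c → x ≅ y [mod n ] → scale c x ≅ scale c y [mod n ]
scale-congʳ {n} {y = y} c (mod-by d refl) = mod-by (scale c d) (Q-identity (env c n y d d)
  (scaleₑ C (X +ₑ scaleₑ D Y)) (scaleₑ C X +ₑ scaleₑ D (scaleₑ C Y)) refl refl refl refl)

scale-identity-mod : ∀ {n} c x → c ≡ + 1 [mod n ] → scale c x ≅ x [mod n ]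
scale-identity-mod c x c≡1 = ≅-trans (scale-congˡ x c≡1) (≅-reflexive (scale-identity x))

≈⇒≅ : ∀ {m} x y → x ≈[ m ] y → x ≅ y [mod + m ]
≈⇒≅ (q a₀ a₁ a₂ a₃) (q b₀ b₁ b₂ b₃) (p₀ , p₁ , p₂ , p₃)
  with ≋⇒≡-mod a₀ b₀ p₀ | ≋⇒≡-mod a₁ b₁ p₁ | ≋⇒≡-mod a₂ b₂ p₂ | ≋⇒≡-mod a₃ b₃ p₃
... | mod-by k₀ e₀ | mod-by k₁ e₁ | mod-by k₂ e₂ | mod-by k₃ e₃ = mod-by (q k₀ k₁ k₂ k₃) (q-cong e₀ e₁ e₂ e₃)

≅⇒≈ : ∀ {m x y} → x ≅ y [mod + m ] → x ≈[ m ] y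
≅⇒≈ {y = q b₀ b₁ b₂ b₃} (mod-by (q k₀ k₁ k₂ k₃) refl) =
    ≡-mod⇒≋ {b = b₀} (mod-by k₀ refl) , ≡-mod⇒≋ {b = b₁} (mod-by k₁ refl)
  , ≡-mod⇒≋ {b = b₂} (mod-by k₂ refl) , ≡-mod⇒≋ {b = b₃} (mod-by k₃ refl)

IsScalarUnitMod-* : ∀ {m} c c′ → IsScalarUnitMod m c → IsScalarUnitMod m c′ → IsScalarUnitMod m (c * c′)
IsScalarUnitMod-* c c′ (d , cd≡1) (d′ , c′d′≡1) = d * d′ , ≡-mod⇒≋ (≡-mod-trans
  (≡-mod-reflexive (interchange c c′ d d′))
  (*-cong-mod (≋⇒≡-mod (c * d) (+ 1) cd≡1) (≋⇒≡-mod (c′ * d′) (+ 1) c′d′≡1)))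

IsScalarUnitMod-resp : ∀ {m c c′} → c ≡ c′ [mod + m ] → IsScalarUnitMod m c → IsScalarUnitMod m c′
IsScalarUnitMod-resp {c = c} c≡c′ (d , cd≡1) = d , ≡-mod⇒≋
  (≡-mod-trans (*-cong-mod (≡-mod-sym c≡c′) (≡-mod-refl {a = d})) (≋⇒≡-mod (c * d) (+ 1) cd≡1))

≅⇒∼ : ∀ {m} x y → x ≅ y [mod + m ] → x ∼[ m ] y
≅⇒∼ x y x≅y =
  + 1 , (+ 1 , ≡-mod⇒≋ (≡-mod-refl {a = + 1})) , ≅⇒≈ (≅-trans x≅y (≅-reflexive (sym (scale-identity y))))

∼-refl : ∀ {m} x → x ∼[ m ] x
∼-refl x = ≅⇒∼ x x ≅-refl

∼-sym : ∀ {m} x y → x ∼[ m ] y → y ∼[ m ] x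
∼-sym {m} x y (c , (d , cd≡1) , x≈cy) = d , (c , dc≡1) , ≅⇒≈ (begin
  y                   ≈⟨ scale-identity-mod (d * c) y (≋⇒≡-mod (d * c) (+ 1) dc≡1) ⟨
  scale (d * c) y     ≡⟨ scale-scale d c y ⟨
  scale d (scale c y) ≈⟨ scale-congʳ d (≈⇒≅ x (scale c y) x≈cy) ⟨
  scale d x           ∎)
  where
  open SetoidReasoning (≅-setoid (+ m))
  dc≡1 : d * c ≋ + 1 [mod m ]
  dc≡1 = subst (λ e → e ≋ + 1 [mod m ]) (ℤ.*-comm c d) cd≡1

∼-trans : ∀ {m} x y z → x ∼[ m ] y → y ∼[ m ] z → x ∼[ m ] z
∼-trans {m} x y z (c , c-unit , x≈cy) (c′ , c′-unit , y≈c′z) =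
  c * c′ , IsScalarUnitMod-* c c′ c-unit c′-unit , ≅⇒≈ (begin
    x                      ≈⟨ ≈⇒≅ x (scale c y) x≈cy ⟩
    scale c y              ≈⟨ scale-congʳ c (≈⇒≅ y (scale c′ z) y≈c′z) ⟩
    scale c (scale c′ z)   ≡⟨ scale-scale c c′ z ⟩
    scale (c * c′) z       ∎)
  where open SetoidReasoning (≅-setoid (+ m))

·-cong-∼ : ∀ {m} x x′ y y′ → x ∼[ m ] x′ → y ∼[ m ] y′ → x · y ∼[ m ] x′ · y′
·-cong-∼ {m} x x′ y y′ (c , c-unit , x≈cx′) (c′ , c′-unit , y≈c′y′) =
  c * c′ , IsScalarUnitMod-* c c′ c-unit c′-unit , ≅⇒≈ (begin
    x · y                      ≈⟨ ·-cong (≈⇒≅ x (scale c x′) x≈cx′) (≈⇒≅ y (scale c′ y′) y≈c′y′) ⟩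
    scale c x′ · scale c′ y′   ≡⟨ scale-·-scale c c′ x′ y′ ⟩
    scale (c * c′) (x′ · y′)   ∎)
  where open SetoidReasoning (≅-setoid (+ m))

∼-unit : ∀ {m} x y → x ∼[ m ] y → IsUnitMod m y → IsUnitMod m x
∼-unit {m} x y (c , (d , cd≡1) , x≈cy) (y′ , yy′≈1 , y′y≈1) = scale d y′ , ≅⇒≈ right , ≅⇒≈ left
  where
  open SetoidReasoning (≅-setoid (+ m))
  cd≡1′ : c * d ≡ + 1 [mod + m ]
  cd≡1′ = ≋⇒≡-mod (c * d) (+ 1) cd≡1
  right : x · scale d y′ ≅ one [mod + m ]
  right = begin
    x · scale d y′           ≈⟨ ·-congˡ (scale d y′) (≈⇒≅ x (scale c y) x≈cy) ⟩
    scale c y · scale d y′   ≡⟨ scale-·-scale c d y y′ ⟩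
    scale (c * d) (y · y′)   ≈⟨ scale-identity-mod (c * d) (y · y′) cd≡1′ ⟩
    y · y′                   ≈⟨ ≈⇒≅ (y · y′) one yy′≈1 ⟩
    one                      ∎
  left : scale d y′ · x ≅ one [mod + m ]
  left = begin
    scale d y′ · x           ≈⟨ ·-congʳ (scale d y′) (≈⇒≅ x (scale c y) x≈cy) ⟩
    scale d y′ · scale c y   ≡⟨ scale-·-scale d c y′ y ⟩
    scale (d * c) (y′ · y)   ≡⟨ cong (λ e → scale e (y′ · y)) (ℤ.*-comm d c) ⟩
    scale (c * d) (y′ · y)   ≈⟨ scale-identity-mod (c * d) (y′ · y) cd≡1′ ⟩
    y′ · y                   ≈⟨ ≈⇒≅ (y′ · y) one y′y≈1 ⟩
    one                      ∎

-- Exhaustive search over residues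

infix 4 _≟Q_

_≟Q_ : DecidableEquality Q
q a₀ a₁ a₂ a₃ ≟Q q b₀ b₁ b₂ b₃ =
  map′ (λ { (refl , refl , refl , refl) → refl }) (λ { refl → refl , refl , refl , refl })
       (a₀ ℤ.≟ b₀ ×-dec a₁ ℤ.≟ b₁ ×-dec a₂ ℤ.≟ b₂ ×-dec a₃ ℤ.≟ b₃)

≋? : ∀ m a b → Dec (a ≋ b [mod m ])
≋? m a b = m ℕ.∣? ∣ a - b ∣

≈? : ∀ m x y → Dec (x ≈[ m ] y)
≈? m (q a₀ a₁ a₂ a₃) (q b₀ b₁ b₂ b₃) = ≋? m a₀ b₀ ×-dec ≋? m a₁ b₁ ×-dec ≋? m a₂ b₂ ×-dec ≋? m a₃ b₃

All-box : (Q → Set) → (A B C D : List ℤ) → Set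
All-box P A B C D = All (λ a → All (λ b → All (λ c → All (λ d → P (q a b c d)) D) C) B) A

Any-box : (Q → Set) → (A B C D : List ℤ) → Set
Any-box P A B C D = Any (λ a → Any (λ b → Any (λ c → Any (λ d → P (q a b c d)) D) C) B) A

module _ {P : Q → Set} where

  all-box? : (∀ x → Dec (P x)) → ∀ A B C D → Dec (All-box P A B C D)
  all-box? P? A B C D = all? (λ a → all? (λ b → all? (λ c → all? (λ d → P? (q a b c d)) D) C) B) A

  any-box? : (∀ x → Dec (P x)) → ∀ A B C D → Dec (Any-box P A B C D)
  any-box? P? A B C D = any? (λ a → any? (λ b → any? (λ c → any? (λ d → P? (q a b c d)) D) C) B) A

  all-box-lookup : ∀ {A B C D a b c d} → All-box P A B C D → a ∈ A → b ∈ B → c ∈ C → d ∈ D → P (q a b c d)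
  all-box-lookup ps a∈A b∈B c∈C d∈D = All.lookup (All.lookup (All.lookup (All.lookup ps a∈A) b∈B) c∈C) d∈D

  any-box-intro : ∀ {A B C D a b c d} → a ∈ A → b ∈ B → c ∈ C → d ∈ D → P (q a b c d) → Any-box P A B C D
  any-box-intro a∈A b∈B c∈C d∈D p = lose a∈A (lose b∈B (lose c∈C (lose d∈D p)))

  any-box-satisfied : ∀ {A B C D} → Any-box P A B C D → Σ Q P
  any-box-satisfied p with Any.satisfied p
  ... | a , p′ with Any.satisfied p′
  ... | b , p″ with Any.satisfied p″
  ... | c , p‴ with Any.satisfied p‴
  ... | d , Pabcd = q a b c d , Pabcd

residues : ℕ → List ℤ
residues m = map +_ (upTo m)

All-residues : ℕ → (Q → Set) → Set
All-residues m P = All-box P (residues m) (residues m) (residues m) (residues m)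

Any-residues : ℕ → (Q → Set) → Set
Any-residues m P = Any-box P (residues m) (residues m) (residues m) (residues m)

module _ (m : ℕ) .{{_ : NonZero m}} where

  reduce : ℤ → ℤ
  reduce a = + (a % + m)

  reduce-∈-residues : ∀ a → reduce a ∈ residues m
  reduce-∈-residues a = ∈-map⁺ +_ (∈-upTo⁺ (n%d<d a (+ m)))

  ≡-mod-reduce : ∀ a → a ≡ reduce a [mod + m ]
  ≡-mod-reduce a =
    mod-by (a / + m) (trans (a≡a%n+[a/n]*n a (+ m)) (cong (_+_ (reduce a)) (ℤ.*-comm (a / + m) (+ m))))

  reduceQ : Q → Q
  reduceQ (q a₀ a₁ a₂ a₃) = q (reduce a₀) (reduce a₁) (reduce a₂) (reduce a₃)

  ≅-reduceQ : ∀ x → x ≅ reduceQ x [mod + m ]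
  ≅-reduceQ (q a₀ a₁ a₂ a₃) with ≡-mod-reduce a₀ | ≡-mod-reduce a₁ | ≡-mod-reduce a₂ | ≡-mod-reduce a₃
  ... | mod-by k₀ e₀ | mod-by k₁ e₁ | mod-by k₂ e₂ | mod-by k₃ e₃ = mod-by (q k₀ k₁ k₂ k₃) (q-cong e₀ e₁ e₂ e₃)

  all-reduced : ∀ {P} → All-residues m P → ∀ x → P (reduceQ x)
  all-reduced ps (q a₀ a₁ a₂ a₃) =
    all-box-lookup ps (reduce-∈-residues a₀) (reduce-∈-residues a₁) (reduce-∈-residues a₂) (reduce-∈-residues a₃)

  any-reduced : ∀ {P} x → P (reduceQ x) → Any-residues m P
  any-reduced (q a₀ a₁ a₂ a₃) =
    any-box-intro (reduce-∈-residues a₀) (reduce-∈-residues a₁) (reduce-∈-residues a₂) (reduce-∈-residues a₃)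

  Σ-residue? : ∀ {P : ℤ → Set} → (∀ a → P a → P (reduce a)) → (∀ a → Dec (P a)) → Dec (Σ ℤ P)
  Σ-residue? P-reduce P? =
    map′ Any.satisfied (λ (a , p) → lose (reduce-∈-residues a) (P-reduce a p)) (any? P? (residues m))

  Σ-reduced? : ∀ {P : Q → Set} → (∀ x → P x → P (reduceQ x)) → (∀ x → Dec (P x)) → Dec (Σ Q P)
  Σ-reduced? P-reduce P? = map′ any-box-satisfied (λ (x , p) → any-reduced x (P-reduce x p))
    (any-box? P? (residues m) (residues m) (residues m) (residues m))

  IsScalarUnitMod? : ∀ c → Dec (IsScalarUnitMod m c)
  IsScalarUnitMod? c = Σ-residue? reduce-inverse (λ d → ≋? m (c * d) (+ 1))
    where
    reduce-inverse : ∀ d → c * d ≋ + 1 [mod m ] → c * reduce d ≋ + 1 [mod m ]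
    reduce-inverse d cd≡1 = ≡-mod⇒≋ (≡-mod-trans
      (*-cong-mod (≡-mod-refl {a = c}) (≡-mod-sym (≡-mod-reduce d))) (≋⇒≡-mod (c * d) (+ 1) cd≡1))

  ∼? : ∀ x y → Dec (x ∼[ m ] y)
  ∼? x y = Σ-residue? reduce-scalar (λ c → IsScalarUnitMod? c ×-dec ≈? m x (scale c y))
    where
    reduce-scalar : ∀ c → IsScalarUnitMod m c × x ≈[ m ] scale c y →
                    IsScalarUnitMod m (reduce c) × x ≈[ m ] scale (reduce c) y
    reduce-scalar c (c-unit , x≈cy) = IsScalarUnitMod-resp (≡-mod-reduce c) c-unit ,
      ≅⇒≈ (≅-trans (≈⇒≅ x (scale c y) x≈cy) (scale-congˡ y (≡-mod-reduce c)))

  IsUnitMod? : ∀ x → Dec (IsUnitMod m x)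
  IsUnitMod? x = Σ-reduced? reduce-inverse (λ y → ≈? m (x · y) one ×-dec ≈? m (y · x) one)
    where
    reduce-inverse : ∀ y → x · y ≈[ m ] one × y · x ≈[ m ] one →
                     x · reduceQ y ≈[ m ] one × reduceQ y · x ≈[ m ] one
    reduce-inverse y (xy≈1 , yx≈1) =
      ≅⇒≈ (≅-trans (·-congʳ x (≅-sym (≅-reduceQ y))) (≈⇒≅ (x · y) one xy≈1)) ,
      ≅⇒≈ (≅-trans (·-congˡ x (≅-sym (≅-reduceQ y))) (≈⇒≅ (y · x) one yx≈1))

-- The units of O

weighted-squaresℕ : List (ℕ × ℤ) → ℕ
weighted-squaresℕ [] = 0
weighted-squaresℕ ((k , a) ∷ ws) = k ℕ.* (∣ a ∣ ℕ.* ∣ a ∣) ℕ.+ weighted-squaresℕ ws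

square-abs : ∀ a → a * a ≡ + (∣ a ∣ ℕ.* ∣ a ∣)
square-abs (+ n) = ℤ.+◃n≡+n (n ℕ.* n)
square-abs -[1+ n ] = refl

weighted-squares≡weighted-squaresℕ : ∀ ws → weighted-squares ws ≡ + weighted-squaresℕ ws
weighted-squares≡weighted-squaresℕ [] = refl
weighted-squares≡weighted-squaresℕ ((k , a) ∷ ws) = begin
  + k * (a * a) + weighted-squares ws
    ≡⟨ cong₂ _+_ (cong (+ k *_) (square-abs a)) (weighted-squares≡weighted-squaresℕ ws) ⟩
  + k * + (∣ a ∣ ℕ.* ∣ a ∣) + + weighted-squaresℕ ws
    ≡⟨ cong (_+ + weighted-squaresℕ ws) (ℤ.pos-* k _) ⟨
  + (k ℕ.* (∣ a ∣ ℕ.* ∣ a ∣)) + + weighted-squaresℕ ws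
    ≡⟨ ℤ.pos-+ _ (weighted-squaresℕ ws) ⟨
  + weighted-squaresℕ ((k , a) ∷ ws)
    ∎
  where open ≡-Reasoning

weighted-square-≤ : ∀ {k a} ws → (k , a) ∈ ws → k ℕ.* (∣ a ∣ ℕ.* ∣ a ∣) ≤ weighted-squaresℕ ws
weighted-square-≤ (_ ∷ ws) (here refl) = ℕ.m≤m+n _ (weighted-squaresℕ ws)
weighted-square-≤ ((k , a) ∷ ws) (there ∈ws) =
  ℕ.≤-trans (weighted-square-≤ ws ∈ws) (ℕ.m≤n+m _ (k ℕ.* (∣ a ∣ ℕ.* ∣ a ∣)))

square-bound : ∀ {K k a r} ws → + K ≡ weighted-squares ws → (k , a) ∈ ws → K < k ℕ.* (suc r ℕ.* suc r) →
               ∣ a ∣ ≤ r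
square-bound {K} {k} {a} {r} ws K≡ws ∈ws K<bound with ∣ a ∣ ℕ.≤? r
... | yes ∣a∣≤r = ∣a∣≤r
... | no ∣a∣≰r = contradiction (ℕ.≤-trans (ℕ.*-monoʳ-≤ k (ℕ.*-mono-≤ r<∣a∣ r<∣a∣)) ka²≤K) (ℕ.<⇒≱ K<bound)
  where
  r<∣a∣ : r < ∣ a ∣
  r<∣a∣ = ℕ.≰⇒> ∣a∣≰r
  ka²≤K : k ℕ.* (∣ a ∣ ℕ.* ∣ a ∣) ≤ K
  ka²≤K = ℕ.≤-trans (weighted-square-≤ ws ∈ws)
    (ℕ.≤-reflexive (ℤ.+-injective (trans (sym (weighted-squares≡weighted-squaresℕ ws)) (sym K≡ws))))

nonneg-if-multiple : ∀ k a n → + suc k * a ≡ + n → a ≡ + ∣ a ∣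
nonneg-if-multiple k (+ _) n eq = refl

nrm-nonneg : ∀ x → nrm x ≡ + ∣ nrm x ∣
nrm-nonneg (q a₀ a₁ a₂ a₃) = nonneg-if-multiple 11 _ _
  (trans (nrm-squares₀ a₀ a₁ a₂ a₃) (weighted-squares≡weighted-squaresℕ (squares₀ a₀ a₁ a₂ a₃)))

nrm-unit : ∀ u v → u · v ≡ one → nrm u ≡ + 1
nrm-unit u v uv≡1 = trans (nrm-nonneg u) (cong +_ (ℕ.m*n≡1⇒m≡1 _ _ ∣nrm-u∣∣nrm-v∣≡1))
  where
  ∣nrm-u∣∣nrm-v∣≡1 : ∣ nrm u ∣ ℕ.* ∣ nrm v ∣ ≡ 1
  ∣nrm-u∣∣nrm-v∣≡1 = trans (sym (ℤ.abs-* (nrm u) (nrm v))) (cong ∣_∣ (trans (sym (nrm-· u v)) (cong nrm uv≡1)))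

interval : ℕ → List ℤ
interval r = map +_ (upTo (suc r)) ++ map -[1+_] (upTo r)

∈-interval : ∀ r a → ∣ a ∣ ≤ r → a ∈ interval r
∈-interval r (+ n) n≤r = ∈-++⁺ˡ (∈-map⁺ +_ (∈-upTo⁺ (s≤s n≤r)))
∈-interval r -[1+ n ] n<r = ∈-++⁺ʳ (map +_ (upTo (suc r))) (∈-map⁺ -[1+_] (∈-upTo⁺ n<r))

units : List Q
units = concatMap (λ u → u ∷ neg u ∷ [])
  ( one
  ∷ q (+ 0) (- + 1) (+ 0) (+ 1) ∷ q (+ 0) (- + 1) (+ 0) (+ 2) ∷ q (+ 0) (+ 0) (+ 0) (+ 1)
  ∷ q (+ 1) (- + 3) (- + 1) (+ 5) ∷ q (+ 1) (- + 3) (- + 1) (+ 6) ∷ q (+ 1) (- + 2) (- + 1) (+ 4)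
  ∷ q (+ 1) (- + 1) (+ 0) (+ 1) ∷ q (+ 1) (- + 1) (+ 0) (+ 2)
  ∷ q (+ 2) (- + 4) (- + 1) (+ 7) ∷ q (+ 2) (- + 3) (- + 1) (+ 5) ∷ q (+ 2) (- + 3) (- + 1) (+ 6)
  ∷ [])

norm-one-∈-units : All-box (λ x → nrm x ≡ + 1 → x ∈ units) (interval 2) (interval 4) (interval 1) (interval 8)
norm-one-∈-units = from-yes (all-box? (λ x → (nrm x ℤ.≟ + 1) →-dec any? (x ≟Q_) units)
  (interval 2) (interval 4) (interval 1) (interval 8))

IsUnitℤ⇒∈units : ∀ u → IsUnitℤ u → u ∈ units
IsUnitℤ⇒∈units (q a₀ a₁ a₂ a₃) (v , uv≡1 , _) = all-box-lookup norm-one-∈-units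
  (∈-interval 2 a₀ (bound 12 (squares₀ a₀ a₁ a₂ a₃) (nrm-squares₀ a₀ a₁ a₂ a₃) (here refl) (from-yes (12 ℕ.<? 18))))
  (∈-interval 4 a₁ (bound 60 (squares₁ a₀ a₁ a₂ a₃) (nrm-squares₁ a₀ a₁ a₂ a₃) (here refl) (from-yes (60 ℕ.<? 75))))
  (∈-interval 1 a₂ (bound 44 (squares₂ a₀ a₁ a₂ a₃) (nrm-squares₂ a₀ a₁ a₂ a₃) (here refl) (from-yes (44 ℕ.<? 88))))
  (∈-interval 8 a₃ (bound 132 (squares₃ a₀ a₁ a₂ a₃) (nrm-squares₃ a₀ a₁ a₂ a₃) (here refl) (from-yes (132 ℕ.<? 162))))
  nrm-u≡1
  where
  u : Q
  u = q a₀ a₁ a₂ a₃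
  nrm-u≡1 : nrm u ≡ + 1
  nrm-u≡1 = nrm-unit u v uv≡1
  bound : ∀ K ws {k a r} → + K * nrm u ≡ weighted-squares ws → (k , a) ∈ ws → K < k ℕ.* (suc r ℕ.* suc r) →
          ∣ a ∣ ≤ r
  bound K ws eq = square-bound ws (trans (sym (ℤ.*-identityʳ (+ K))) (trans (cong (+ K *_) (sym nrm-u≡1)) eq))

units-invertible : All (λ u → Any (λ v → u · v ≡ one × v · u ≡ one) units) units
units-invertible = from-yes (all? (λ u → any? (λ v → (u · v ≟Q one) ×-dec (v · u ≟Q one)) units) units)

∈units⇒IsUnitℤ : ∀ {u} → u ∈ units → IsUnitℤ u
∈units⇒IsUnitℤ u∈units = Any.satisfied (All.lookup units-invertible u∈units)

-- The complement of φ₃(G(ℤ))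

g : Q
g = q (+ 1) (+ 1) (+ 0) (+ 0)

representatives : List Q
representatives = one ∷ g ∷ []

Complement : Q → Set
Complement x = Any (x ∼[ 3 ]_) representatives

Complement? : ∀ x → Dec (Complement x)
Complement? x = any? (∼? 3 x) representatives

Complement-respects : ∀ x y → x ∼[ 3 ] y → Complement x → Complement y
Complement-respects x y x∼y = Any.map (λ {e} x∼e → ∼-trans y x e (∼-sym x y x∼y) x∼e)

∈-representatives⇒Complement : ∀ {e} → e ∈ representatives → Complement e
∈-representatives⇒Complement {e} = Any.map (λ { refl → ∼-refl e })

representatives-invertible : All (IsUnitMod 3) representatives
representatives-invertible = from-yes (all? (IsUnitMod? 3) representatives)

representatives-closed : All (λ e → All (λ e′ → Complement (e · e′)) representatives) representatives
representatives-closed =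
  from-yes (all? (λ e → all? (λ e′ → Complement? (e · e′)) representatives) representatives)

representatives-left-inverses : All (λ e → All-residues 3 (λ y → e · y ∼[ 3 ] one → Complement y)) representatives
representatives-left-inverses = from-yes (all? (λ e →
  all-box? (λ y → ∼? 3 (e · y) one →-dec Complement? y) (residues 3) (residues 3) (residues 3) (residues 3))
  representatives)

g≁one : ¬ (g ∼[ 3 ] one)
g≁one = from-no (∼? 3 g one)

units-≁-g : All (λ u → ¬ (u ∼[ 3 ] g)) units
units-≁-g = from-yes (all? (λ u → ¬? (∼? 3 u g)) units)

units-∼-injective : All (λ u → All (λ v → u ∼[ 3 ] v → (u ≡ v) ⊎ (u ≡ neg v)) units) units
units-∼-injective =
  from-yes (all? (λ u → all? (λ v → ∼? 3 u v →-dec ((u ≟Q v) ⊎-dec (u ≟Q neg v))) units) units)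

units-·-representatives-cover :
  All-residues 3 (λ x → IsUnitMod 3 x → Any (λ u → Any (λ s → x ∼[ 3 ] u · s) representatives) units)
units-·-representatives-cover = from-yes (all-box?
  (λ x → IsUnitMod? 3 x →-dec any? (λ u → any? (λ s → ∼? 3 x (u · s)) representatives) units)
  (residues 3) (residues 3) (residues 3) (residues 3))

Complement-isSubgroup : IsSubgroup 3 Complement
Complement-isSubgroup = record
  { respects = Complement-respects
  ; units    = Complement-units
  ; has-one  = here (∼-refl one)
  ; closed·  = Complement-closed·
  ; closed⁻¹ = Complement-closed⁻¹
  }
  where
  Complement-units : ∀ x → Complement x → IsUnitMod 3 x
  Complement-units x Cx with find Cx
  ... | e , e∈reps , x∼e = ∼-unit x e x∼e (All.lookup representatives-invertible e∈reps)

  Complement-closed· : ∀ x y → Complement x → Complement y → Complement (x · y)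
  Complement-closed· x y Cx Cy with find Cx | find Cy
  ... | e , e∈reps , x∼e | e′ , e′∈reps , y∼e′ =
    Complement-respects (e · e′) (x · y) (∼-sym (x · y) (e · e′) (·-cong-∼ x e y e′ x∼e y∼e′))
      (All.lookup (All.lookup representatives-closed e∈reps) e′∈reps)

  Complement-closed⁻¹ : ∀ x y → Complement x → x · y ≈[ 3 ] one → Complement y
  Complement-closed⁻¹ x y Cx xy≈1 with find Cx
  ... | e , e∈reps , x∼e =
    Complement-respects y′ y y′∼y (all-reduced 3 (All.lookup representatives-left-inverses e∈reps) y ey′∼1)
    where
    y′ : Q
    y′ = reduceQ 3 y
    y′∼y : y′ ∼[ 3 ] y
    y′∼y = ≅⇒∼ y′ y (≅-sym (≅-reduceQ 3 y))
    ey′∼1 : e · y′ ∼[ 3 ] one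
    ey′∼1 = ∼-trans (e · y′) (x · y) one (·-cong-∼ e x y′ y (∼-sym x e x∼e) y′∼y)
                    (≅⇒∼ (x · y) one (≈⇒≅ (x · y) one xy≈1))

Complement-isoC₂ : IsoC₂ 3 Complement
Complement-isoC₂ = g , there (here (∼-refl g)) , g≁one , one-or-g
  where
  one-or-g : ∀ x → Complement x → (x ∼[ 3 ] one) ⊎ (x ∼[ 3 ] g)
  one-or-g x (here x∼1) = inj₁ x∼1
  one-or-g x (there (here x∼g)) = inj₂ x∼g

Complement-isCongruencePair : IsCongruencePair 3 Complement
Complement-isCongruencePair = record { injective = injective ; trivial-meet = trivial-meet ; covers = covers }
  where
  injective : ∀ u v → IsUnitℤ u → IsUnitℤ v → u ∼[ 3 ] v → (u ≡ v) ⊎ (u ≡ neg v)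
  injective u v u-unit v-unit =
    All.lookup (All.lookup units-∼-injective (IsUnitℤ⇒∈units u u-unit)) (IsUnitℤ⇒∈units v v-unit)

  trivial-meet : ∀ u x → IsUnitℤ u → Complement x → u ∼[ 3 ] x → x ∼[ 3 ] one
  trivial-meet u x u-unit (here x∼1) u∼x = x∼1
  trivial-meet u x u-unit (there (here x∼g)) u∼x =
    ⊥-elim (All.lookup units-≁-g (IsUnitℤ⇒∈units u u-unit) (∼-trans u x g u∼x x∼g))

  covers : ∀ x → IsUnitMod 3 x → Σ Q λ u → Σ Q λ s → IsUnitℤ u × Complement s × (x ∼[ 3 ] (u · s))
  covers x x-unit = factor (find (all-reduced 3 units-·-representatives-cover x x′-unit))
    where
    x′ : Q
    x′ = reduceQ 3 x
    x′-unit : IsUnitMod 3 x′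
    x′-unit = ∼-unit x′ x (≅⇒∼ x′ x (≅-sym (≅-reduceQ 3 x))) x-unit
    factor : (Σ Q λ u → u ∈ units × Any (λ s → x′ ∼[ 3 ] u · s) representatives) →
             Σ Q λ u → Σ Q λ s → IsUnitℤ u × Complement s × (x ∼[ 3 ] (u · s))
    factor (u , u∈units , x′∈u·reps) with find x′∈u·reps
    ... | s , s∈reps , x′∼us = u , s , ∈units⇒IsUnitℤ u∈units , ∈-representatives⇒Complement s∈reps ,
                               ∼-trans x x′ (u · s) (≅⇒∼ x x′ (≅-reduceQ 3 x)) x′∼us

proposition5p4 : Σ (Q → Set) λ H → IsSubgroup 3 H × IsoC₂ 3 H × IsCongruencePair 3 H
proposition5p4 = Complement , Complement-isSubgroup , Complement-isoC₂ , Complement-isCongruencePair
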